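{- Let $X$ be a finite set and $\mathcal{D}\subseteq\mathcal{R}(X)$. Then $\mathcal{D}$ is a median domain if and only if $\mathcal{D}$ is a closed Condorcet domain.
   Context: $\mathcal{R}(X)$ is the set of strict linear orders on $X$. A profile over $\mathcal{D}$ is $(R_1,\dots,R_n)\in\mathcal{D}^n$ ($n\ge1$), odd if $n$ is odd; its majority relation $P$ is given by $xPy$ iff more than half of the voters rank $x$ above $y$. $\mathcal{D}$ is a Condorcet domain if the majority relation of every profile over $\mathcal{D}$ is acyclic (no $x_1Px_2P\cdots Px_mPx_1$), and a closed Condorcet domain if additionally the majority relation of every odd profile over $\mathcal{D}$ belongs to $\mathcal{D}$. For $R,R'\in\mathcal{R}(X)$ let $[R,R']=\{Q\in\mathcal{R}(X): Q\supseteq R\cap R'\}$. $\mathcal{D}$ is a median domain if for all $R_1,R_2,R_3\in\mathcal{D}$ there is $R\in\mathcal{D}\cap[R_1,R_2]\cap[R_1,R_3]\cap[R_2,R_3]$. -}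

module Defs where

open import Data.Nat using (ℕ; zero; suc; _+_; _*_; _<ᵇ_)
open import Data.Bool using (Bool; true; false; if_then_else_)
open import Data.Fin using (Fin)
open import Data.Vec using (Vec; lookup; tabulate; foldr)
open import Data.Vec.Relation.Unary.All using (All)
open import Data.Product using (Σ; _×_; ∃)
open import Data.Sum using (_⊎_)
open import Relation.Nullary using (¬_)
open import Relation.Binary.PropositionalEquality using (_≡_; _≢_)
open import Relation.Binary.Construct.Closure.Transitive using (TransClosure)

-- The finite set X is represented (up to bijection) by Fin m.
-- A binary relation on Fin m is stored as a Boolean m×m matrix, so that
-- two relations are equal iff they are propositionally equal.
BRel : ℕ → Set
BRel m = Vec (Vec Bool m) m

_⟨_⟩_ : ∀ {m} → Fin m → BRel m → Fin m → Set
x ⟨ R ⟩ y = lookup (lookup R x) y ≡ true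

IsStrictLinearOrder : ∀ {m} → BRel m → Set
IsStrictLinearOrder {m} R =
  (∀ (x : Fin m) → ¬ (x ⟨ R ⟩ x)) ×
  (∀ (x y z : Fin m) → x ⟨ R ⟩ y → y ⟨ R ⟩ z → x ⟨ R ⟩ z) ×
  (∀ (x y : Fin m) → x ≢ y → (x ⟨ R ⟩ y) ⊎ (y ⟨ R ⟩ x))

-- A domain 𝓓 is a predicate on relations, required to be ⊆ 𝓡(X).
Domain : ℕ → Set₁
Domain m = BRel m → Set

IsDomainOfLinearOrders : ∀ {m} → Domain m → Set
IsDomainOfLinearOrders D = ∀ R → D R → IsStrictLinearOrder R

votes : ∀ {m n} → Vec (BRel m) n → Fin m → Fin m → ℕ
votes prof x y = foldr _ (λ R acc → (if lookup (lookup R x) y then 1 else 0) + acc) 0 prof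

majority : ∀ {m n} → Vec (BRel m) n → BRel m
majority {m} {n} prof = tabulate λ x → tabulate λ y → n <ᵇ (2 * votes prof x y)

Acyclic : ∀ {m} → BRel m → Set
Acyclic {m} P = ∀ (x : Fin m) → ¬ TransClosure (λ a b → a ⟨ P ⟩ b) x x

IsCondorcetDomain : ∀ {m} → Domain m → Set
IsCondorcetDomain {m} D =
  ∀ (n : ℕ) (prof : Vec (BRel m) (suc n)) → All D prof → Acyclic (majority prof)

IsClosedCondorcetDomain : ∀ {m} → Domain m → Set
IsClosedCondorcetDomain {m} D =
  IsCondorcetDomain D ×
  (∀ (k : ℕ) (prof : Vec (BRel m) (suc (2 * k))) → All D prof → D (majority prof))

-- Q ∈ [R, R'] : Q ⊇ R ∩ R'  (Q ∈ 𝓡(X) is imposed separately)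
Between : ∀ {m} → BRel m → BRel m → BRel m → Set
Between {m} Q R R' = ∀ (x y : Fin m) → x ⟨ R ⟩ y → x ⟨ R' ⟩ y → x ⟨ Q ⟩ y

IsMedianDomain : ∀ {m} → Domain m → Set
IsMedianDomain D =
  ∀ R₁ R₂ R₃ → D R₁ → D R₂ → D R₃ →
  ∃ λ R → D R × Between R R₁ R₂ × Between R R₁ R₃ × Between R R₂ R₃

module Submission where

-- (⇐) If D is closed, the majority relation of three voters R₁ R₂ R₃ from D
--     lies in D, and it contains every pair ranked alike by two of them, so it
--     is a median of R₁ R₂ R₃.
-- (⇒) Encode a relation as its Boolean entries on the coordinates (x , y).
--     A median of three linear orders keeps every coordinate on which two of
--     them agree; a Helly argument then shows: if every TWO coordinates of a
--     target can be matched by one member of a median domain, the whole target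
--     is matched by one member.  For an odd profile the majority value at each
--     coordinate is backed by a strict majority of voters, and two strict
--     majorities share a voter, so the majority relation is pairwise matched
--     and hence lies in D.  Finally any profile's majority is contained in the
--     majority of the odd profile obtained by doubling every voter and adding
--     one; the latter is a linear order in D, so the former is acyclic.

open import Defs
open import Data.Nat using (ℕ; suc; _+_; _*_; _<ᵇ_; _≤_; _<_; s<s⁻¹)
open import Data.Nat.Properties
open import Data.Bool using (Bool; true; false; T; _∧_; _∨_; if_then_else_)
  renaming (_≟_ to _≟ᵇ_)
open import Data.Bool.Properties using (T-≡; ¬-not; not-¬)
open import Data.Fin using (Fin) renaming (_≟_ to _≟ᶠ_)
open import Data.Vec using (Vec; []; _∷_; lookup; tabulate; count)
open import Data.Vec.Properties using (lookup∘tabulate; tabulate∘lookup; tabulate-cong)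
open import Data.Vec.Relation.Unary.All using (All; []; _∷_)
open import Data.List using (List; []; _∷_; allFin; cartesianProduct)
import Data.List.Relation.Unary.All as List
open import Data.List.Membership.Propositional using (_∈_)
open import Data.List.Membership.Propositional.Properties using (∈-allFin; ∈-cartesianProduct⁺)
open import Data.Product using (_×_; ∃; _,_; proj₁; proj₂)
open import Data.Sum using (inj₁; inj₂)
open import Function using (_∘_; Equivalence)
open import Relation.Nullary using (¬_; yes; no; does; contradiction)
open import Relation.Unary using (Decidable)
open import Relation.Binary.PropositionalEquality
open import Relation.Binary.Construct.Closure.Transitive using (TransClosure; [_]; _∷_)

-- Arithmetic of strict majorities: "t out of N is a strict majority"
-- is written N < 2 * t, which can only tie when N is even.
Odd : ℕ → Set
Odd N = ∃ λ k → N ≡ suc (2 * k)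

-- With an odd number of voters there are no ties: if a + t = N and t is
-- not a strict majority, then a is.
odd-complement : ∀ k a t → a + t ≡ suc (2 * k) → ¬ (suc (2 * k) < 2 * t) →
                 suc (2 * k) < 2 * a
odd-complement k a t a+t≡N N≮2t = +-cancelʳ-< (2 * t) N (2 * a) (begin-strict
    N + 2 * t      <⟨ +-monoʳ-< N twice-t<N ⟩
    N + N          ≡⟨ cong (N +_) (sym (+-identityʳ N)) ⟩
    2 * N          ≡⟨ cong (2 *_) (sym a+t≡N) ⟩
    2 * (a + t)    ≡⟨ *-distribˡ-+ 2 a t ⟩
    2 * a + 2 * t  ∎)
  where
  open ≤-Reasoning
  N = suc (2 * k)
  twice-t<N : 2 * t < N
  twice-t<N = ≤∧≢⇒< (≮⇒≥ N≮2t) (even≢odd t k)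

majorities-overlap : ∀ {N a b} → N < 2 * a → N < 2 * b → N < a + b
majorities-overlap {N} {a} {b} N<2a N<2b = *-cancelˡ-< 2 N (a + b) (begin-strict
    2 * N          ≡⟨ cong (N +_) (+-identityʳ N) ⟩
    N + N          <⟨ +-mono-< N<2a N<2b ⟩
    2 * a + 2 * b  ≡⟨ sym (*-distribˡ-+ 2 a b) ⟩
    2 * (a + b)    ∎)
  where open ≤-Reasoning

doubled-majority : ∀ {N t} → N < 2 * t → suc (N * 2) < 2 * (t * 2)
doubled-majority {N} {t} N<2t = begin-strict
    suc (N * 2)  <⟨ n<1+n (suc (N * 2)) ⟩
    suc N * 2    ≤⟨ *-monoˡ-≤ 2 N<2t ⟩
    2 * t * 2    ≡⟨ *-assoc 2 t 2 ⟩
    2 * (t * 2)  ∎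
  where open ≤-Reasoning

module Voters {A : Set} where

  count-false+true : ∀ {n} (f : A → Bool) (xs : Vec A n) →
    count (λ x → f x ≟ᵇ false) xs + count (λ x → f x ≟ᵇ true) xs ≡ n
  count-false+true f [] = refl
  count-false+true f (x ∷ xs) with f x
  ... | true  = trans (+-suc _ _) (cong suc (count-false+true f xs))
  ... | false = cong suc (count-false+true f xs)

  common-member : ∀ {n} {S P Q : A → Set} (P? : Decidable P) (Q? : Decidable Q)
    (xs : Vec A n) → All S xs → n < count P? xs + count Q? xs →
    ∃ λ x → S x × P x × Q x
  common-member {suc n} P? Q? (x ∷ xs) (sx ∷ sxs) n<P+Q with P? x | Q? x
  ... | yes px | yes qx = x , sx , px , qx
  ... | yes _  | no _   = common-member P? Q? xs sxs (s<s⁻¹ n<P+Q)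
  ... | no _   | yes _  =
    common-member P? Q? xs sxs
      (s<s⁻¹ (subst (suc n <_) (+-suc (count P? xs) (count Q? xs)) n<P+Q))
  ... | no _   | no _   = common-member P? Q? xs sxs (<-trans (n<1+n _) n<P+Q)

  some-voter : ∀ {n} {S : A → Set} (xs : Vec A (suc n)) → All S xs → ∃ S
  some-voter (x ∷ _) (sx ∷ _) = x , sx

  double : ∀ {n} → Vec A n → Vec A (n * 2)
  double []       = []
  double (x ∷ xs) = x ∷ x ∷ double xs

  All-double : ∀ {n} {S : A → Set} {xs : Vec A n} → All S xs → All S (double xs)
  All-double []         = []
  All-double (sx ∷ sxs) = sx ∷ sx ∷ All-double sxs

  count-double : ∀ {n} {P : A → Set} (P? : Decidable P) (xs : Vec A n) →
    count P? (double xs) ≡ count P? xs * 2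
  count-double P? [] = refl
  count-double P? (x ∷ xs) with does (P? x)
  ... | true  = cong (suc ∘ suc) (count-double P? xs)
  ... | false = count-double P? xs

  count-∷ : ∀ {n} {P : A → Set} (P? : Decidable P) x (xs : Vec A n) →
    count P? xs ≤ count P? (x ∷ xs)
  count-∷ P? x xs with does (P? x)
  ... | true  = n≤1+n _
  ... | false = ≤-refl

open Voters

Pair : ℕ → Set
Pair m = Fin m × Fin m

entry : ∀ {m} → BRel m → Pair m → Bool
entry R (x , y) = lookup (lookup R x) y

pairs : ∀ m → List (Pair m)
pairs m = cartesianProduct (allFin m) (allFin m)

∈-pairs : ∀ {m} (c : Pair m) → c ∈ pairs m
∈-pairs (x , y) = ∈-cartesianProduct⁺ (∈-allFin x) (∈-allFin y)

entries-equal : ∀ {m} {A B : BRel m} → (∀ c → entry A c ≡ entry B c) → A ≡ B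
entries-equal same = vec-ext (λ x → vec-ext (λ y → same (x , y)))
  where
  vec-ext : ∀ {X : Set} {n} {u v : Vec X n} → (∀ i → lookup u i ≡ lookup v i) → u ≡ v
  vec-ext {u = u} {v} same-lookups =
    trans (sym (tabulate∘lookup u)) (trans (tabulate-cong same-lookups) (tabulate∘lookup v))

supporters : ∀ {m n} → Vec (BRel m) n → Pair m → Bool → ℕ
supporters prof c b = count (λ R → entry R c ≟ᵇ b) prof

votes≡supporters : ∀ {m n} (prof : Vec (BRel m) n) x y →
  votes prof x y ≡ supporters prof (x , y) true
votes≡supporters []         x y = refl
votes≡supporters (R ∷ prof) x y with lookup (lookup R x) y
... | true  = cong suc (votes≡supporters prof x y)
... | false = votes≡supporters prof x y

majority-entry : ∀ {m n} (prof : Vec (BRel m) n) c →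
  entry (majority prof) c ≡ (n <ᵇ 2 * supporters prof c true)
majority-entry {n = n} prof (x , y) = begin
    entry (majority prof) (x , y)
  ≡⟨ cong (λ row → lookup row y) (lookup∘tabulate _ x) ⟩
    lookup (tabulate λ y → n <ᵇ 2 * votes prof x y) y
  ≡⟨ lookup∘tabulate _ y ⟩
    (n <ᵇ 2 * votes prof x y)
  ≡⟨ cong (λ v → n <ᵇ 2 * v) (votes≡supporters prof x y) ⟩
    (n <ᵇ 2 * supporters prof (x , y) true)
  ∎
  where open ≡-Reasoning

majority-ranks : ∀ {m n} (prof : Vec (BRel m) n) c →
  n < 2 * supporters prof c true → entry (majority prof) c ≡ true
majority-ranks prof c n<2t = trans (majority-entry prof c) (Equivalence.to T-≡ (<⇒<ᵇ n<2t))

ranked-by-majority : ∀ {m n} (prof : Vec (BRel m) n) c →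
  entry (majority prof) c ≡ true → n < 2 * supporters prof c true
ranked-by-majority {n = n} prof c ranked =
  <ᵇ⇒< n _ (Equivalence.from T-≡ (trans (sym (majority-entry prof c)) ranked))

majority-supported : ∀ {m N} → Odd N → (prof : Vec (BRel m) N) → ∀ c →
  N < 2 * supporters prof c (entry (majority prof) c)
majority-supported {N = N} (k , refl) prof c
  rewrite majority-entry prof c with N <ᵇ 2 * supporters prof c true in eq
... | true  = <ᵇ⇒< N _ (subst T (sym eq) _)
... | false = odd-complement k (supporters prof c false) (supporters prof c true)
                (count-false+true (λ R → entry R c) prof)
                (λ N<2t → subst T eq (<⇒<ᵇ N<2t))

module StrictLinearOrder {m} {R : BRel m} (lin : IsStrictLinearOrder R) where

  irreflexive : ∀ x → ¬ (x ⟨ R ⟩ x)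
  irreflexive = proj₁ lin

  transitive : ∀ x y z → x ⟨ R ⟩ y → y ⟨ R ⟩ z → x ⟨ R ⟩ z
  transitive = proj₁ (proj₂ lin)

  asymmetric : ∀ {x y} → x ⟨ R ⟩ y → ¬ (y ⟨ R ⟩ x)
  asymmetric xRy yRx = irreflexive _ (transitive _ _ _ xRy yRx)

  reversed : ∀ {x y} → x ≢ y → ¬ (x ⟨ R ⟩ y) → y ⟨ R ⟩ x
  reversed x≢y ¬xRy with proj₂ (proj₂ lin) _ _ x≢y
  ... | inj₁ xRy = contradiction xRy ¬xRy
  ... | inj₂ yRx = yRx

acyclic-below : ∀ {m} {P R : BRel m} → IsStrictLinearOrder R →
  (∀ x y → x ⟨ P ⟩ y → x ⟨ R ⟩ y) → Acyclic P
acyclic-below {P = P} {R} lin P⊆R x cycle = irreflexive x (along cycle)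
  where
  open StrictLinearOrder {R = R} lin
  along : ∀ {a b} → TransClosure (λ a b → a ⟨ P ⟩ b) a b → a ⟨ R ⟩ b
  along [ aPb ]        = P⊆R _ _ aPb
  along (aPb ∷ bP⁺c) = transitive _ _ _ (P⊆R _ _ aPb) (along bP⁺c)

Keeps : ∀ {S C : Set} → (S → C → Bool) → S → S → S → Set
Keeps value s s₁ s₂ = ∀ c → value s₁ c ≡ value s₂ c → value s c ≡ value s₁ c

module Helly {S C : Set} (value : S → C → Bool) (D : S → Set)
  (median : ∀ {s₁ s₂ s₃} → D s₁ → D s₂ → D s₃ →
     ∃ λ s → D s × Keeps value s s₁ s₂ × Keeps value s s₁ s₃ × Keeps value s s₂ s₃)
  (target : C → Bool) where

  Realised : List C → Set
  Realised cs = ∃ λ s → D s × List.All (λ c → value s c ≡ target c) cs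

  kept : ∀ {s s₁ s₂} → Keeps value s s₁ s₂ → ∀ {c} →
    value s₁ c ≡ target c → value s₂ c ≡ target c → value s c ≡ target c
  kept keeps {c} e₁ e₂ = trans (keeps c (trans e₁ (sym e₂))) e₁

  -- The median of three members, each matching all but one of a, b, c,
  -- matches all of them.
  realise-three : ∀ a b c cs → Realised (b ∷ c ∷ cs) → Realised (a ∷ c ∷ cs) →
    Realised (a ∷ b ∷ cs) → Realised (a ∷ b ∷ c ∷ cs)
  realise-three a b c cs (s₁ , d₁ , b₁ List.∷ c₁ List.∷ cs₁)
                         (s₂ , d₂ , a₂ List.∷ c₂ List.∷ cs₂)
                         (s₃ , d₃ , a₃ List.∷ b₃ List.∷ _) with median d₁ d₂ d₃
  ... | s , d , k₁₂ , k₁₃ , k₂₃ =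
    s , d , kept k₂₃ a₂ a₃ List.∷ kept k₁₃ b₁ b₃ List.∷ kept k₁₂ c₁ c₂
        List.∷ List.zipWith (λ (e₁ , e₂) → kept k₁₂ e₁ e₂) (cs₁ , cs₂)

  module _ (pairwise : ∀ a b → Realised (a ∷ b ∷ [])) where

    realise-with-pair : ∀ cs a b → Realised (a ∷ b ∷ cs)
    realise-with-pair []       = pairwise
    realise-with-pair (c ∷ cs) a b = realise-three a b c cs
      (realise-with-pair cs b c) (realise-with-pair cs a c) (realise-with-pair cs a b)

    realise : ∃ D → ∀ cs → Realised cs
    realise (s , d) []  = s , d , List.[]
    realise _ (a ∷ []) with pairwise a a
    ... | s , d , e List.∷ _ = s , d , e List.∷ List.[]
    realise _ (a ∷ b ∷ cs) = realise-with-pair cs a b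

    realise-everywhere : ∃ D → (cs : List C) → (∀ c → c ∈ cs) →
      ∃ λ s → D s × ∀ c → value s c ≡ target c
    realise-everywhere inhabited cs complete with realise inhabited cs
    ... | s , d , matches = s , d , λ c → List.lookup matches (complete c)

-- A linear order between two linear orders keeps their common entries: on
-- common true entries by definition, on common false entries because both
-- then rank the pair the other way.
between-keeps : ∀ {m} {R A B : BRel m} → IsStrictLinearOrder R →
  IsStrictLinearOrder A → IsStrictLinearOrder B → Between R A B → Keeps entry R A B
between-keeps {R = R} {A} {B} linR linA linB between (x , y) A≡B with entry A (x , y) in eA
... | true  = between x y eA (sym A≡B)
... | false = ¬-not ¬xRy
  where
  ¬xRy : ¬ (x ⟨ R ⟩ y)
  ¬xRy xRy with x ≟ᶠ y
  ... | yes refl = StrictLinearOrder.irreflexive {R = R} linR x xRy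
  ... | no x≢y   = StrictLinearOrder.asymmetric {R = R} linR xRy
    (between y x (StrictLinearOrder.reversed {R = A} linA x≢y (not-¬ eA))
                 (StrictLinearOrder.reversed {R = B} linB x≢y (not-¬ (sym A≡B))))

module MedianDomain {m} {D : Domain m} (lin : IsDomainOfLinearOrders D)
                    (med : IsMedianDomain D) where

  median-keeps : ∀ {R₁ R₂ R₃} → D R₁ → D R₂ → D R₃ →
    ∃ λ R → D R × Keeps entry R R₁ R₂ × Keeps entry R R₁ R₃ × Keeps entry R R₂ R₃
  median-keeps {R₁} {R₂} {R₃} d₁ d₂ d₃ with med R₁ R₂ R₃ d₁ d₂ d₃
  ... | R , d , b₁₂ , b₁₃ , b₂₃ = R , d ,
    between-keeps {R = R} {R₁} {R₂} (lin R d) (lin R₁ d₁) (lin R₂ d₂) b₁₂ ,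
    between-keeps {R = R} {R₁} {R₃} (lin R d) (lin R₁ d₁) (lin R₃ d₃) b₁₃ ,
    between-keeps {R = R} {R₂} {R₃} (lin R d) (lin R₂ d₂) (lin R₃ d₃) b₂₃

  -- Any two coordinates of the majority relation are matched by a voter
  -- backing both majority values; Helly gives a member matching all.
  majority-closed : ∀ {N} → Odd N → (prof : Vec (BRel m) N) → All D prof →
    D (majority prof)
  majority-closed odd@(_ , refl) prof ds =
    subst D (entries-equal (proj₂ (proj₂ realised))) (proj₁ (proj₂ realised))
    where
    open Helly entry D median-keeps (entry (majority prof))
    pairwise : ∀ c c′ → Realised (c ∷ c′ ∷ [])
    pairwise c c′ with common-member (λ R → entry R c ≟ᵇ entry (majority prof) c)
                                     (λ R → entry R c′ ≟ᵇ entry (majority prof) c′)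
      prof ds (majorities-overlap {a = supporters prof c (entry (majority prof) c)}
                                  {b = supporters prof c′ (entry (majority prof) c′)}
                 (majority-supported odd prof c) (majority-supported odd prof c′))
    ... | R , d , e , e′ = R , d , e List.∷ e′ List.∷ List.[]
    realised : ∃ λ R → D R × ∀ c → entry R c ≡ entry (majority prof) c
    realised = realise-everywhere pairwise (some-voter prof ds) (pairs m) ∈-pairs

  -- The majority of any profile is contained in the majority of the odd
  -- profile made of one voter plus every voter twice, a linear order in D.
  condorcet : IsCondorcetDomain D
  condorcet n prof@(R₀ ∷ _) ds@(d₀ ∷ _) =
    acyclic-below {P = majority prof} {majority extended}
      (lin (majority extended) (majority-closed odd extended (d₀ ∷ All-double ds)))
      grows
    where
    extended : Vec (BRel m) (suc (suc n * 2))
    extended = R₀ ∷ double prof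
    odd : Odd (suc (suc n * 2))
    odd = suc n , cong suc (*-comm (suc n) 2)
    grows : ∀ x y → x ⟨ majority prof ⟩ y → x ⟨ majority extended ⟩ y
    grows x y xPy = majority-ranks extended (x , y) (<-≤-trans
      (doubled-majority {t = supporters prof (x , y) true}
                        (ranked-by-majority prof (x , y) xPy))
      (*-monoʳ-≤ 2 (≤-trans (≤-reflexive (sym (count-double ranks-x-y prof)))
                            (count-∷ ranks-x-y R₀ (double prof)))))
      where
      ranks-x-y : Decidable (λ (R : BRel m) → entry R (x , y) ≡ true)
      ranks-x-y R = entry R (x , y) ≟ᵇ true

maj3 : Bool → Bool → Bool → Bool
maj3 a b c = if a then b ∨ c else b ∧ c

three-voter-majority : ∀ {m} (R₁ R₂ R₃ : BRel m) c →
  entry (majority (R₁ ∷ R₂ ∷ R₃ ∷ [])) c ≡ maj3 (entry R₁ c) (entry R₂ c) (entry R₃ c)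
three-voter-majority R₁ R₂ R₃ c =
  trans (majority-entry (R₁ ∷ R₂ ∷ R₃ ∷ []) c)
        (count-three (entry R₁ c) (entry R₂ c) (entry R₃ c))
  where
  count-three : ∀ a b c → (3 <ᵇ 2 * count (_≟ᵇ true) (a ∷ b ∷ c ∷ [])) ≡ maj3 a b c
  count-three true  true  true  = refl
  count-three true  true  false = refl
  count-three true  false true  = refl
  count-three true  false false = refl
  count-three false true  true  = refl
  count-three false true  false = refl
  count-three false false true  = refl
  count-three false false false = refl

maj3-12 : ∀ {a b} c → a ≡ true → b ≡ true → maj3 a b c ≡ true
maj3-12 c refl refl = refl

maj3-13 : ∀ {a c} b → a ≡ true → c ≡ true → maj3 a b c ≡ true
maj3-13 true  refl refl = refl
maj3-13 false refl refl = refl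

maj3-23 : ∀ {b c} a → b ≡ true → c ≡ true → maj3 a b c ≡ true
maj3-23 true  refl refl = refl
maj3-23 false refl refl = refl

majority-of-three-between : ∀ {m} (R₁ R₂ R₃ : BRel m) →
  let M = majority (R₁ ∷ R₂ ∷ R₃ ∷ []) in
  Between M R₁ R₂ × Between M R₁ R₃ × Between M R₂ R₃
majority-of-three-between R₁ R₂ R₃ =
  (λ x y e₁ e₂ → trans (three-voter-majority R₁ R₂ R₃ (x , y)) (maj3-12 _ e₁ e₂)) ,
  (λ x y e₁ e₃ → trans (three-voter-majority R₁ R₂ R₃ (x , y)) (maj3-13 _ e₁ e₃)) ,
  (λ x y e₂ e₃ → trans (three-voter-majority R₁ R₂ R₃ (x , y)) (maj3-23 _ e₂ e₃))

theorem2 : (m : ℕ) (D : Domain m) → IsDomainOfLinearOrders D →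
    (IsMedianDomain D → IsClosedCondorcetDomain D) × (IsClosedCondorcetDomain D → IsMedianDomain D)
theorem2 m D lin = median⇒closed , closed⇒median
  where
  median⇒closed : IsMedianDomain D → IsClosedCondorcetDomain D
  median⇒closed med =
    condorcet , λ k prof → majority-closed (k , refl) prof
    where open MedianDomain lin med

  -- the median of R₁ R₂ R₃ is their majority relation, which lies in D
  closed⇒median : IsClosedCondorcetDomain D → IsMedianDomain D
  closed⇒median (_ , closed) R₁ R₂ R₃ d₁ d₂ d₃ =
    majority (R₁ ∷ R₂ ∷ R₃ ∷ []) , closed 1 _ (d₁ ∷ d₂ ∷ d₃ ∷ []) ,
    majority-of-three-between R₁ R₂ R₃
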